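{- Let $t\ge 2$, $k>t$, and $\ell\ge 1$ be integers. If a $\mathsf{PHHF}(t;k,(v_1,\dots,v_t),t)$ exists, then a $\mathsf{PHHF}(t+1;\ell k,(\ell v_1,\dots,\ell v_t,k),t+1)$ exists. Moreover, if a fractal $\mathsf{PHHF}(t;k,(v_1,\dots,v_t),t)$ exists, then a fractal $\mathsf{PHHF}(t+1;\ell k,(\ell v_1,\dots,\ell v_t,k),t+1)$ exists.
   Context: An $\mathsf{HHF}(N;k,(w_1,\dots,w_N))$ is an $N\times k$ array in which row $i$ contains at most $w_i$ distinct symbols. Given a set $S$ of columns and a partition of $S$ into $p$ classes (some possibly empty), a row $r$ separates it if any two columns in distinct classes have distinct entries in row $r$. A $\mathsf{DHHF}(N;k,(w_1,\dots,w_N),t,p)$ is an $\mathsf{HHF}(N;k,(w_1,\dots,w_N))$ in which every partition of every $t$-set of columns into $p$ classes is separated by some row. A $\mathsf{PHHF}(N;k,(w_1,\dots,w_N),t)$ is a $\mathsf{DHHF}(N;k,(w_1,\dots,w_N),t,t)$, i.e. every $t$-set of columns has a row in which its $t$ entries are distinct. A $\mathsf{DHHF}(t;k,(v_1,\dots,v_t),t,p)$ is fractal if $t\le 2$, or if for each row $j$, deleting row $j$ yields a fractal $\mathsf{DHHF}(t-1;k,(v_1,\dots,v_{j-1},v_{j+1},\dots,v_t),t-1,\min(p,t-1))$; a fractal $\mathsf{PHHF}$ is a fractal $\mathsf{DHHF}$ with $p=t$. -}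

module Defs where

open import Data.Nat using (ℕ; zero; suc; _⊓_)
open import Data.Fin using (Fin; zero; suc; punchIn)
open import Data.Product using (Σ; ∃; _×_)
open import Data.Unit using (⊤)
open import Relation.Binary.PropositionalEquality using (_≡_; _≢_)
open import Function.Definitions using (Injective)

HHF : (N k : ℕ) → (w : Fin N → ℕ) → Set
HHF N k w = (i : Fin N) → Fin k → Fin (w i)

-- Row r separates the partition (of the column set {cols a}) given by the class
-- assignment cls : Fin t → Fin p (classes may be empty).
Separates : ∀ {N k t p} {w : Fin N → ℕ} → HHF N k w → Fin N →
            (Fin t → Fin k) → (Fin t → Fin p) → Set
Separates A r cols cls =
  ∀ a b → cls a ≢ cls b → A r (cols a) ≢ A r (cols b)

IsDHHF : (N k : ℕ) (w : Fin N → ℕ) (t p : ℕ) → HHF N k w → Set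
IsDHHF N k w t p A =
  (cols : Fin t → Fin k) → Injective _≡_ _≡_ cols →
  (cls : Fin t → Fin p) → ∃ λ r → Separates A r cols cls

IsPHHF : (N k : ℕ) (w : Fin N → ℕ) (t : ℕ) → HHF N k w → Set
IsPHHF N k w t A = IsDHHF N k w t t A

IsFractalDHHF : (t k : ℕ) (v : Fin t → ℕ) (p : ℕ) → HHF t k v → Set
FractalRest : (t k : ℕ) (v : Fin t → ℕ) (p : ℕ) → HHF t k v → Set

IsFractalDHHF t k v p A = IsDHHF t k v t p A × FractalRest t k v p A

FractalRest zero k v p A = ⊤
FractalRest (suc zero) k v p A = ⊤
FractalRest (suc (suc zero)) k v p A = ⊤
FractalRest (suc (suc (suc n))) k v p A =
  (j : Fin (suc (suc (suc n)))) →
  IsFractalDHHF (suc (suc n)) k (λ i → v (punchIn j i)) (p ⊓ suc (suc n))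
    (λ i → A (punchIn j i))

IsFractalPHHF : (t k : ℕ) (v : Fin t → ℕ) → HHF t k v → Set
IsFractalPHHF t k v A = IsFractalDHHF t k v t A

snoc : ∀ {t} → (Fin t → ℕ) → ℕ → Fin (suc t) → ℕ
snoc {zero} v x zero = x
snoc {suc t} v x zero = v zero
snoc {suc t} v x (suc i) = snoc {t} (λ j → v (suc j)) x i

-- Write a column of the new array as a pair (q , c) ∈ Fin ℓ × Fin k: the row
-- coming from row Aᵢ of A sends it to (q , Aᵢ c), the new last row sends it to c.
-- Given t + 1 distinct columns, either their components c are distinct and the
-- last row separates them, or these components take at most t values.  Those
-- values lie among t distinct columns of A (as t ≤ k), which some row Aᵢ
-- separates; then row i separates the given columns, because equal entries force
-- equal q and equal Aᵢ c, hence equal c.  Deleting the last row leaves the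
-- inflation of A, and deleting row i leaves the same construction applied to A
-- without row i, so fractality is inherited by induction on the number of rows.
module Submission where

open import Defs
open import Data.Nat using (ℕ; zero; suc; _*_; _≤_; _<_)
open import Data.Nat.Properties using (≤-refl; ≤-trans; <⇒≤; ⊓-glb; n≤1+n)
open import Data.Fin using (Fin; zero; suc; toℕ; fromℕ; inject≤; punchIn; punchOut; remQuot; combine; _≟_)
open import Data.Fin.Properties
  using ( toℕ-injective; inject≤-injective; combine-remQuot; combine-injective
        ; any?; ¬∀⟶∃¬; <⇒notInjective; punchIn-punchOut)
open import Data.Vec.Functional using (Vector; _∷_; insertAt)
open import Data.Vec.Functional.Properties using (insertAt-lookup; insertAt-punchIn)
open import Data.Product using (∃; ∃₂; _×_; _,_; proj₁; proj₂)
open import Data.Product.Properties using (,-injectiveˡ; ,-injectiveʳ)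
open import Data.Sum using (_⊎_; inj₁; inj₂)
open import Data.Unit using (⊤; tt)
open import Relation.Nullary using (¬_; yes; no; contradiction)
open import Relation.Nullary.Decidable using (_×-dec_; ¬?; decidable-stable)
open import Relation.Binary.PropositionalEquality
open import Function using (_∘_)
open import Function.Definitions using (Injective)

IsInjective : ∀ {A B : Set} → (A → B) → Set
IsInjective f = Injective _≡_ _≡_ f

-- Arrays with one entry type for all rows, so that rows can be deleted and
-- appended without the row-dependent alphabets of HHF.
Array : Set → ℕ → ℕ → Set
Array X m K = Fin m → Fin K → X

record IsPerfect {X m K} (t : ℕ) (R : Array X m K) : Set where
  field
    separator : (cols : Fin t → Fin K) → IsInjective cols → ∃ λ r → IsInjective (R r ∘ cols)

open IsPerfect

IsFractal : ∀ {X m K} → Array X m K → Set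
DeletionsFractal : ∀ {X K} m → Array X m K → Set

IsFractal {m = m} R = IsPerfect m R × DeletionsFractal m R

DeletionsFractal zero R = ⊤
DeletionsFractal (suc zero) R = ⊤
DeletionsFractal (suc (suc zero)) R = ⊤
DeletionsFractal (suc (suc (suc n))) R = ∀ j → IsFractal (R ∘ punchIn j)

FactorsThrough : ∀ {X Y m K} → Array X m K → Array Y m K → Set
FactorsThrough R S = ∀ i x y → S i x ≡ S i y → R i x ≡ R i y

perfect-factorsThrough : ∀ {X Y m K t} {R : Array X m K} {S : Array Y m K} →
  FactorsThrough R S → IsPerfect t R → IsPerfect t S
separator (perfect-factorsThrough R⇐S P) cols cols-inj =
  let r , sep = separator P cols cols-inj in r , sep ∘ R⇐S r _ _

fractal-factorsThrough : ∀ {X Y m K} {R : Array X m K} {S : Array Y m K} →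
  FactorsThrough R S → IsFractal R → IsFractal S
fractal-factorsThrough {m = zero} R⇐S (P , _) = perfect-factorsThrough R⇐S P , tt
fractal-factorsThrough {m = suc zero} R⇐S (P , _) = perfect-factorsThrough R⇐S P , tt
fractal-factorsThrough {m = suc (suc zero)} R⇐S (P , _) = perfect-factorsThrough R⇐S P , tt
fractal-factorsThrough {m = suc (suc (suc n))} R⇐S (P , rest) =
  perfect-factorsThrough R⇐S P , λ j → fractal-factorsThrough (R⇐S ∘ punchIn j) (rest j)

fractal-cong : ∀ {X m K} {R S : Array X m K} → (∀ i → R i ≡ S i) → IsFractal R → IsFractal S
fractal-cong R≗S = fractal-factorsThrough λ i x y → subst (λ row → row x ≡ row y) (sym (R≗S i))

perfect-one : ∀ {X m K} (R : Array X (suc m) K) → IsPerfect 1 R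
separator (perfect-one R) cols _ = zero , λ { {zero} {zero} _ → refl }

fractal-punchIn : ∀ {X K} n {R : Array X (suc (suc n)) K} →
  IsFractal R → ∀ j → IsFractal (R ∘ punchIn j)
fractal-punchIn zero {R} _ j = perfect-one (R ∘ punchIn j) , tt
fractal-punchIn (suc n) (_ , rest) = rest

_∷ʳ_ : ∀ {A : Set} {m} → Vector A m → A → Vector A (suc m)
xs ∷ʳ x = insertAt xs (fromℕ _) x

∷ʳ-punchIn-punchIn : ∀ {A : Set} m (xs : Vector A (suc m)) (x : A) (j i : Fin (suc m)) →
  (xs ∷ʳ x) (punchIn (punchIn (fromℕ (suc m)) j) i) ≡ ((xs ∘ punchIn j) ∷ʳ x) i
∷ʳ-punchIn-punchIn m xs x zero i = refl
∷ʳ-punchIn-punchIn (suc m) xs x (suc j) zero = refl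
∷ʳ-punchIn-punchIn (suc m) xs x (suc j) (suc i) = ∷ʳ-punchIn-punchIn m (xs ∘ suc) x j i

≡-or-punchIn : ∀ {n} (p j : Fin (suc n)) → j ≡ p ⊎ ∃ λ j′ → j ≡ punchIn p j′
≡-or-punchIn p j with j ≟ p
... | yes j≡p = inj₁ j≡p
... | no j≢p = inj₂ (punchOut (j≢p ∘ sym) , sym (punchIn-punchOut (j≢p ∘ sym)))

Covers : ∀ {m n k} → (Fin m → Fin k) → (Fin n → Fin k) → Set
Covers g f = ∀ a → ∃ λ b → g b ≡ f a

injective-on-image : ∀ {A B X : Set} {h : B → X} {g : A → B} {a b u v} →
  IsInjective (h ∘ g) → g a ≡ u → g b ≡ v → h u ≡ h v → u ≡ v
injective-on-image {g = g} h∘g-inj refl refl e = cong g (h∘g-inj e)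

∃-∉-image : ∀ {n k} → n < k → (g : Fin n → Fin k) → ∃ λ y → ∀ b → g b ≢ y
∃-∉-image {n} {k} n<k g =
  let y , y∉ = ¬∀⟶∃¬ k (λ y → ∃ λ b → g b ≡ y) (λ y → any? λ b → g b ≟ y) g-not-onto
  in y , λ b gb≡y → y∉ (b , gb≡y)
  where
  g-not-onto : ¬ (∀ y → ∃ λ b → g b ≡ y)
  g-not-onto onto = <⇒notInjective n<k λ {y} {y′} e →
    trans (sym (proj₂ (onto y))) (trans (cong g e) (proj₂ (onto y′)))

∷-injective : ∀ {A : Set} {n} {y : A} {g : Fin n → A} →
  (∀ b → g b ≢ y) → IsInjective g → IsInjective (y ∷ g)
∷-injective y∉ g-inj {zero} {zero} _ = refl
∷-injective y∉ g-inj {zero} {suc j} e = contradiction (sym e) (y∉ j)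
∷-injective y∉ g-inj {suc i} {zero} e = contradiction e (y∉ i)
∷-injective y∉ g-inj {suc i} {suc j} e = cong suc (g-inj e)

cover-by-injection : ∀ {n k} → n ≤ k → (f : Fin n → Fin k) →
  ∃ λ (g : Fin n → Fin k) → IsInjective g × Covers g f
cover-by-injection {zero} _ f = f , (λ { {()} }) , λ ()
cover-by-injection {suc n} n<k f
  with g , g-inj , g-covers ← cover-by-injection (<⇒≤ n<k) (f ∘ suc)
  with any? (λ b → g b ≟ f zero)
... | yes f0∈g =
  let y , y∉ = ∃-∉-image n<k g
  in y ∷ g , ∷-injective y∉ g-inj , λ
    { zero → suc (proj₁ f0∈g) , proj₂ f0∈g
    ; (suc a) → suc (proj₁ (g-covers a)) , proj₂ (g-covers a) }
... | no f0∉g =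
  f zero ∷ g , ∷-injective (λ b e → f0∉g (b , e)) g-inj , λ
    { zero → zero , refl
    ; (suc a) → suc (proj₁ (g-covers a)) , proj₂ (g-covers a) }

injective-or-collision : ∀ {n k} (f : Fin n → Fin k) →
  IsInjective f ⊎ ∃₂ λ a b → a ≢ b × f a ≡ f b
injective-or-collision f with any? (λ a → any? λ b → ¬? (a ≟ b) ×-dec (f a ≟ f b))
... | yes (a , b , a≢b , fa≡fb) = inj₂ (a , b , a≢b , fa≡fb)
... | no no-collision = inj₁ λ {a} {b} fa≡fb →
  decidable-stable (a ≟ b) λ a≢b → no-collision (a , b , a≢b , fa≡fb)

injective-or-cover-by-injection : ∀ {n k} → n ≤ k → (f : Fin (suc n) → Fin k) →
  IsInjective f ⊎ ∃ λ (g : Fin n → Fin k) → IsInjective g × Covers g f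
injective-or-cover-by-injection n≤k f with injective-or-collision f
... | inj₁ f-inj = inj₁ f-inj
... | inj₂ (a , b , a≢b , fa≡fb) with g , g-inj , g-covers ← cover-by-injection n≤k (f ∘ punchIn b) =
  inj₂ (g , g-inj , covers)
  where
  covers-≢b : ∀ {c} → b ≢ c → ∃ λ d → g d ≡ f c
  covers-≢b b≢c =
    let d , e = g-covers (punchOut b≢c) in d , trans e (cong f (punchIn-punchOut b≢c))
  covers : Covers g f
  covers c with c ≟ b
  ... | yes refl = let d , e = covers-≢b (a≢b ∘ sym) in d , trans e fa≡fb
  ... | no c≢b = covers-≢b (c≢b ∘ sym)

toArray : ∀ {N K w} → HHF N K w → Array ℕ N K
toArray A i x = toℕ (A i x)

isDHHF⇒isPerfect : ∀ {N K w t p} {A : HHF N K w} → t ≤ p →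
  IsDHHF N K w t p A → IsPerfect t (toArray A)
separator (isDHHF⇒isPerfect t≤p D) cols cols-inj =
  let r , sep = D cols cols-inj (λ a → inject≤ a t≤p)
  in r , λ {a} {b} e → decidable-stable (a ≟ b) λ a≢b →
       sep a b (a≢b ∘ inject≤-injective t≤p t≤p a b) (toℕ-injective e)

isPerfect⇒isDHHF : ∀ {N K w t p} {A : HHF N K w} → IsPerfect t (toArray A) → IsDHHF N K w t p A
isPerfect⇒isDHHF P cols cols-inj cls =
  let r , sep = separator P cols cols-inj
  in r , λ a b cls≢ e → cls≢ (cong cls (sep (cong toℕ e)))

isFractalDHHF⇒isFractal : ∀ {t K w p} {A : HHF t K w} → t ≤ p →
  IsFractalDHHF t K w p A → IsFractal (toArray A)
isFractalDHHF⇒isFractal {zero} t≤p (D , _) = isDHHF⇒isPerfect t≤p D , tt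
isFractalDHHF⇒isFractal {suc zero} t≤p (D , _) = isDHHF⇒isPerfect t≤p D , tt
isFractalDHHF⇒isFractal {suc (suc zero)} t≤p (D , _) = isDHHF⇒isPerfect t≤p D , tt
isFractalDHHF⇒isFractal {suc (suc (suc n))} t≤p (D , rest) =
  isDHHF⇒isPerfect t≤p D ,
  λ j → isFractalDHHF⇒isFractal (⊓-glb (≤-trans (n≤1+n _) t≤p) ≤-refl) (rest j)

isFractal⇒isFractalDHHF : ∀ {t K w p} {A : HHF t K w} → IsFractal (toArray A) → IsFractalDHHF t K w p A
isFractal⇒isFractalDHHF {zero} (P , _) = isPerfect⇒isDHHF P , tt
isFractal⇒isFractalDHHF {suc zero} (P , _) = isPerfect⇒isDHHF P , tt
isFractal⇒isFractalDHHF {suc (suc zero)} (P , _) = isPerfect⇒isDHHF P , tt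
isFractal⇒isFractalDHHF {suc (suc (suc n))} (P , rest) =
  isPerfect⇒isDHHF P , λ j → isFractal⇒isFractalDHHF (rest j)

appendRow : ∀ {t K x} {v : Fin t → ℕ} → HHF t K v → (Fin K → Fin x) → HHF (suc t) K (snoc v x)
appendRow {zero} A c zero = c
appendRow {suc t} A c zero = A zero
appendRow {suc t} A c (suc i) = appendRow (λ j → A (suc j)) c i

appendRow-factorsThrough : ∀ {Y : Set} {t K x} {v : Fin t → ℕ} {A : HHF t K v} {c : Fin K → Fin x}
  {R : Array Y t K} {g : Fin K → Y} →
  FactorsThrough R (toArray A) → (∀ a b → toℕ (c a) ≡ toℕ (c b) → g a ≡ g b) →
  FactorsThrough (R ∷ʳ g) (toArray (appendRow A c))
appendRow-factorsThrough {t = zero} R⇐A g⇐c zero = g⇐c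
appendRow-factorsThrough {t = suc t} R⇐A g⇐c zero = R⇐A zero
appendRow-factorsThrough {t = suc t} R⇐A g⇐c (suc i) = appendRow-factorsThrough (R⇐A ∘ suc) g⇐c i

module Inflation (ℓ k : ℕ) where

  quot : Fin (ℓ * k) → Fin ℓ
  quot x = proj₁ (remQuot {ℓ} k x)

  rem : Fin (ℓ * k) → Fin k
  rem x = proj₂ (remQuot {ℓ} k x)

  quot-rem-injective : ∀ {x y} → quot x ≡ quot y → rem x ≡ rem y → x ≡ y
  quot-rem-injective {x} {y} q≡ r≡ = begin
    x                          ≡⟨ combine-remQuot {ℓ} k x ⟨
    combine (quot x) (rem x)   ≡⟨ cong₂ combine q≡ r≡ ⟩
    combine (quot y) (rem y)   ≡⟨ combine-remQuot {ℓ} k y ⟩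
    y                          ∎
    where open ≡-Reasoning

  inflate : ∀ {m} → Array ℕ m k → Array (ℕ × ℕ) m (ℓ * k)
  inflate R i x = toℕ (quot x) , R i (rem x)

  -- The 0 is a dummy: entries are only ever compared within a row.
  remRow : Fin (ℓ * k) → ℕ × ℕ
  remRow x = 0 , toℕ (rem x)

  extend : ∀ {m} → Array ℕ m k → Array (ℕ × ℕ) (suc m) (ℓ * k)
  extend R = inflate R ∷ʳ remRow

  inflate-separates : ∀ {t n m} {R : Array ℕ m k} → IsPerfect t R →
    (cols : Fin n → Fin (ℓ * k)) → IsInjective cols →
    (g : Fin t → Fin k) → IsInjective g → Covers g (rem ∘ cols) →
    ∃ λ r → IsInjective (inflate R r ∘ cols)
  inflate-separates {R = R} P cols cols-inj g g-inj g-covers =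
    let r , Rr∘g-inj = separator P g g-inj
    in r , λ {a} {b} e → cols-inj (quot-rem-injective
         (toℕ-injective (,-injectiveˡ e))
         (injective-on-image {h = R r} {g = g} Rr∘g-inj
           (proj₂ (g-covers a)) (proj₂ (g-covers b)) (,-injectiveʳ e)))

  inflate-perfect : ∀ {t m} {R : Array ℕ m k} → t ≤ k → IsPerfect t R → IsPerfect t (inflate R)
  separator (inflate-perfect t≤k P) cols cols-inj =
    let g , g-inj , g-covers = cover-by-injection t≤k (rem ∘ cols)
    in inflate-separates P cols cols-inj g g-inj g-covers

  extend-perfect : ∀ {t m} {R : Array ℕ m k} → t ≤ k → IsPerfect t R → IsPerfect (suc t) (extend R)
  separator (extend-perfect {m = m} {R} t≤k P) cols cols-inj
    with injective-or-cover-by-injection t≤k (rem ∘ cols)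
  ... | inj₁ rem-inj =
    fromℕ m , λ e → rem-inj (toℕ-injective (,-injectiveʳ
      (subst (λ row → row _ ≡ row _) (insertAt-lookup (inflate R) (fromℕ m) remRow) e)))
  ... | inj₂ (g , g-inj , g-covers) =
    let r , sep = inflate-separates P cols cols-inj g g-inj g-covers
    in punchIn (fromℕ m) r ,
       subst (λ row → IsInjective (row ∘ cols))
         (sym (insertAt-punchIn (inflate R) (fromℕ m) remRow r)) sep

  inflate-fractal : ∀ {m} {R : Array ℕ m k} → m ≤ k → IsFractal R → IsFractal (inflate R)
  inflate-fractal {zero} m≤k (P , _) = inflate-perfect m≤k P , tt
  inflate-fractal {suc zero} m≤k (P , _) = inflate-perfect m≤k P , tt
  inflate-fractal {suc (suc zero)} m≤k (P , _) = inflate-perfect m≤k P , tt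
  inflate-fractal {suc (suc (suc n))} m≤k (P , rest) =
    inflate-perfect m≤k P , λ j → inflate-fractal (≤-trans (n≤1+n _) m≤k) (rest j)

  extend-fractal : ∀ {m} {R : Array ℕ m k} → m ≤ k → IsFractal R → IsFractal (extend R)
  extend-punchIn-fractal : ∀ {m} {R : Array ℕ (suc m) k} → suc m ≤ k → IsFractal R →
    ∀ j → j ≡ fromℕ (suc m) ⊎ ∃ (λ j′ → j ≡ punchIn (fromℕ (suc m)) j′) →
    IsFractal (extend R ∘ punchIn j)

  extend-fractal {zero} m≤k (P , _) = extend-perfect m≤k P , tt
  extend-fractal {suc zero} m≤k (P , _) = extend-perfect m≤k P , tt
  extend-fractal {suc (suc n)} m≤k F@(P , _) =
    extend-perfect m≤k P , λ j → extend-punchIn-fractal m≤k F j (≡-or-punchIn _ j)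

  extend-punchIn-fractal {m} {R} m≤k F j (inj₁ refl) =
    fractal-cong (sym ∘ insertAt-punchIn (inflate R) (fromℕ (suc m)) remRow) (inflate-fractal m≤k F)
  extend-punchIn-fractal {zero} {R} _ _ j (inj₂ _) = perfect-one (extend R ∘ punchIn j) , tt
  extend-punchIn-fractal {suc n} {R} m≤k F j (inj₂ (j′ , refl)) =
    fractal-cong (sym ∘ ∷ʳ-punchIn-punchIn (suc n) (inflate R) remRow j′)
      (extend-fractal (≤-trans (n≤1+n _) m≤k) (fractal-punchIn n F j′))

  inflateHHF : ∀ {t} {v : Fin t → ℕ} → HHF t k v → HHF t (ℓ * k) (λ i → ℓ * v i)
  inflateHHF A i x = combine (quot x) (A i (rem x))

  extendHHF : ∀ {t} {v : Fin t → ℕ} → HHF t k v → HHF (suc t) (ℓ * k) (snoc (λ i → ℓ * v i) k)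
  extendHHF A = appendRow (inflateHHF A) rem

  extend-factorsThrough-extendHHF : ∀ {t} {v : Fin t → ℕ} (A : HHF t k v) →
    FactorsThrough (extend (toArray A)) (toArray (extendHHF A))
  extend-factorsThrough-extendHHF A =
    appendRow-factorsThrough inflate⇐inflateHHF λ _ _ → cong (0 ,_)
    where
    inflate⇐inflateHHF : FactorsThrough (inflate (toArray A)) (toArray (inflateHHF A))
    inflate⇐inflateHHF i x y e =
      let q≡ , c≡ = combine-injective (quot x) (A i (rem x)) (quot y) (A i (rem y))
                                      (toℕ-injective e)
      in cong₂ _,_ (cong toℕ q≡) (cong toℕ c≡)

-- The construction needs only t ≤ k.
theorem14 : (t k ℓ : ℕ) → 2 ≤ t → t < k → 1 ≤ ℓ → (v : Fin t → ℕ) →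
    ((∃ λ (A : HHF t k v) → IsPHHF t k v t A) →
      ∃ λ (B : HHF (suc t) (ℓ * k) (snoc (λ i → ℓ * v i) k)) →
        IsPHHF (suc t) (ℓ * k) (snoc (λ i → ℓ * v i) k) (suc t) B)
    × ((∃ λ (A : HHF t k v) → IsFractalPHHF t k v A) →
      ∃ λ (B : HHF (suc t) (ℓ * k) (snoc (λ i → ℓ * v i) k)) →
        IsFractalPHHF (suc t) (ℓ * k) (snoc (λ i → ℓ * v i) k) B)
theorem14 t k ℓ _ t<k _ v =
  (λ (A , P) → extendHHF A ,
    isPerfect⇒isDHHF (perfect-factorsThrough (extend-factorsThrough-extendHHF A)
      (extend-perfect (<⇒≤ t<k) (isDHHF⇒isPerfect {A = A} ≤-refl P)))) ,
  (λ (A , F) → extendHHF A ,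
    isFractal⇒isFractalDHHF (fractal-factorsThrough (extend-factorsThrough-extendHHF A)
      (extend-fractal (<⇒≤ t<k) (isFractalDHHF⇒isFractal {A = A} ≤-refl F))))
  where open Inflation ℓ k
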